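{- Let $t\ge 0$ and $n\ge 1$ be integers, and let $\overline{p}_t(n)$ denote the number of overpartitions of $n$ in which the difference between the largest part and the smallest part is at most $t$. Then $\overline{p}_t(n)$ is even. Moreover, $\overline{p}_t(n)$ is divisible by $4$ if and only if $n$ is not a perfect square.
   Context: An overpartition of a positive integer $n$ is a partition of $n$ (a non-increasing sequence of positive integers summing to $n$) in which the first occurrence of each distinct part may be overlined. -}

module Defs where

open import Data.Nat using (ℕ; zero; suc; _+_; _*_; _∸_; _≤_; _⊔_; _⊓_)
open import Data.Nat.Properties using (_≟_; _≤?_)
open import Data.Bool using (Bool; true; false)
open import Data.Bool.Properties using () renaming (_≟_ to _≟ᵇ_)
open import Data.Product using (_×_; _,_; proj₁; proj₂; ∃)
open import Data.List using (List; []; _∷_; map; length; filter; concatMap; concat; upTo; applyUpTo)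
open import Data.Nat.ListAction using (sum)
open import Data.List.Relation.Unary.All using (All; all?)
open import Data.List.Relation.Unary.Linked using (Linked; linked?)
open import Relation.Binary.PropositionalEquality using (_≡_; _≢_)
open import Relation.Nullary using (Dec; yes; no; ¬_)
open import Relation.Nullary.Decidable using (_×-dec_; _→-dec_; ¬?)

-- An overpartition is represented as a list of (part , overlined?) pairs,
-- read from the first (largest) part to the last (smallest) part.
OPart : Set
OPart = ℕ × Bool

parts : List OPart → List ℕ
parts = map proj₁

NonIncr : OPart → OPart → Set
NonIncr a b = proj₁ b ≤ proj₁ a

-- Consecutive entries: an entry may be overlined only if it is the first
-- occurrence of its value (parts are non-increasing, so the first occurrence
-- is the one whose predecessor has a different value).
OverlineOK : OPart → OPart → Set
OverlineOK a b = proj₂ b ≡ true → proj₁ a ≢ proj₁ b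

-- The first entry may always be overlined; it is the first occurrence.
IsOverpartition : ℕ → List OPart → Set
IsOverpartition n xs =
  All (λ p → 1 ≤ proj₁ p) xs
  × sum (parts xs) ≡ n
  × Linked NonIncr xs
  × Linked OverlineOK xs

largestPart : List ℕ → ℕ
largestPart = Data.List.foldr _⊔_ 0

smallestPart : List ℕ → ℕ
smallestPart []       = 0
smallestPart (x ∷ xs) = Data.List.foldr _⊓_ x xs

IsOverpartitionT : ℕ → ℕ → List OPart → Set
IsOverpartitionT t n xs =
  IsOverpartition n xs × largestPart (parts xs) ∸ smallestPart (parts xs) ≤ t

isOverpartitionT? : (t n : ℕ) → (xs : List OPart) → Dec (IsOverpartitionT t n xs)
isOverpartitionT? t n xs =
  (all? (λ p → 1 ≤? proj₁ p) xs
   ×-dec (sum (parts xs) ≟ n)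
   ×-dec linked? (λ a b → proj₁ b ≤? proj₁ a) xs
   ×-dec linked? (λ a b → (proj₂ b ≟ᵇ true) →-dec ¬? (proj₁ a ≟ proj₁ b)) xs)
  ×-dec (largestPart (parts xs) ∸ smallestPart (parts xs) ≤? t)

entries : ℕ → List OPart
entries n = concatMap (λ k → (suc k , false) ∷ (suc k , true) ∷ []) (upTo n)

listsOfLength : ℕ → List OPart → List (List OPart)
listsOfLength zero    es = [] ∷ []
listsOfLength (suc k) es = concatMap (λ e → map (e ∷_) (listsOfLength k es)) es

-- Finite, duplicate-free superset of all overpartitions of n:
-- every overpartition of n has at most n parts, each in 1..n.
candidates : ℕ → List (List OPart)
candidates n = concat (applyUpTo (λ k → listsOfLength k (entries n)) (suc n))

pbarT : ℕ → ℕ → ℕ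
pbarT t n = length (filter (isOverpartitionT? t n) (candidates n))

IsPerfectSquare : ℕ → Set
IsPerfectSquare n = ∃ λ m → m * m ≡ n

-- Toggling the overline of the largest part pairs off the overpartitions counted by p̄_t(n),
-- so p̄_t(n) = 2H with H the number of those whose largest part is not overlined. Inside H,
-- toggling the overline of the first occurrence of any smaller part is again an involution; its
-- fixed points are the overpartitions with all parts equal, one for each divisor of n (their
-- spread is 0 ≤ t). Hence H ≡ d(n) (mod 2), and d(n) is odd exactly when n is a square, since
-- the divisors pair up as m ↔ n/m.

module Submission where

open import Defs
open import Data.Nat using (ℕ; zero; suc; _+_; _*_; _∸_; _≤_; _<_; z≤n; s≤s; parity)
open import Data.Nat.Divisibility using (_∣_; divides; ∣m∣n⇒∣m+n; ∣-refl; m∣m*n; *-cancelˡ-∣; *-monoʳ-∣)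
open import Data.Product using (_×_; _,_; proj₁; proj₂)
open import Function.Bundles using (_⇔_; mk⇔; Equivalence)
open import Relation.Nullary using (¬_; Dec; does; yes; no; contradiction)

open import Algebra.Properties.CommutativeSemigroup as CommSemigroupProps using ()
open import Data.Bool using (true; false; if_then_else_)
import Data.Bool.Properties as Bool
open import Data.List using (List; []; _∷_; _++_; map; concat; concatMap; applyUpTo; upTo; length; filter)
open import Data.List.Properties
  using (map-∘; map-cong; map-++; map-upTo; map-applyUpTo; foldr-forcesᵇ; foldr-preservesᵇ)
open import Data.List.Relation.Unary.All as All using (All; []; _∷_; all?)
import Data.List.Relation.Unary.All.Properties as All
open import Data.List.Relation.Unary.Linked using (Linked; [-]; _∷_; linked?)
open import Data.List.Relation.Unary.Linked.Properties using (Linked⇒All)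
open import Data.Nat.ListAction using (sum)
open import Data.Nat.ListAction.Properties using (sum-++)
open import Data.Nat.Properties using (_≟_; _≤?_)
import Data.Nat.Properties as ℕ
open import Data.Parity.Base using (0ℙ; 1ℙ) renaming (_+_ to _ℙ+_)
import Data.Parity.Properties as ℙ
open import Function using (_∘_; id)
open import Function.Construct.Composition using (_⇔-∘_)
open import Relation.Binary using (Rel; tri<; tri≈; tri>)
open import Relation.Binary.PropositionalEquality
  using (_≡_; _≢_; refl; sym; trans; cong; cong₂; subst; module ≡-Reasoning)
open import Relation.Nullary.Decidable using (does-⇔; dec-false; _×-dec_; _→-dec_; ¬?)
open import Relation.Unary using (Pred; Decidable)

open CommSemigroupProps ℕ.+-commutativeSemigroup using (interchange)

∑< : ℕ → (ℕ → ℕ) → ℕ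
∑< n f = sum (applyUpTo f n)

syntax ∑< n (λ j → e) = ∑[ j < n ] e

∑<-zero : ∀ n → ∑[ j < n ] 0 ≡ 0
∑<-zero zero    = refl
∑<-zero (suc n) = ∑<-zero n

∑<-cong : ∀ n {f g : ℕ → ℕ} → (∀ j → j < n → f j ≡ g j) → ∑< n f ≡ ∑< n g
∑<-cong zero    f≡g = refl
∑<-cong (suc n) f≡g = cong₂ _+_ (f≡g 0 (s≤s z≤n)) (∑<-cong n (λ j j<n → f≡g (suc j) (s≤s j<n)))

∑<-distrib-+ : ∀ n (f g : ℕ → ℕ) → ∑[ j < n ] (f j + g j) ≡ ∑< n f + ∑< n g
∑<-distrib-+ zero    f g = refl
∑<-distrib-+ (suc n) f g = begin
  (f 0 + g 0) + ∑[ j < n ] (f (suc j) + g (suc j))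
    ≡⟨ cong (f 0 + g 0 +_) (∑<-distrib-+ n (f ∘ suc) (g ∘ suc)) ⟩
  (f 0 + g 0) + (∑< n (f ∘ suc) + ∑< n (g ∘ suc))
    ≡⟨ interchange (f 0) (g 0) _ _ ⟩
  (f 0 + ∑< n (f ∘ suc)) + (g 0 + ∑< n (g ∘ suc)) ∎
  where open ≡-Reasoning

*-distribˡ-∑< : ∀ c n (f : ℕ → ℕ) → ∑[ j < n ] (c * f j) ≡ c * ∑< n f
*-distribˡ-∑< c zero    f = sym (ℕ.*-zeroʳ c)
*-distribˡ-∑< c (suc n) f =
  trans (cong (c * f 0 +_) (*-distribˡ-∑< c n (f ∘ suc))) (sym (ℕ.*-distribˡ-+ c (f 0) _))

parity-+-cong : ∀ {a b c d} → parity a ≡ parity b → parity c ≡ parity d →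
                parity (a + c) ≡ parity (b + d)
parity-+-cong {a} {b} {c} {d} a≡b c≡d = begin
  parity (a + c)          ≡⟨ ℙ.+-homo-+ a c ⟩
  parity a ℙ+ parity c    ≡⟨ cong₂ _ℙ+_ a≡b c≡d ⟩
  parity b ℙ+ parity d    ≡⟨ ℙ.+-homo-+ b d ⟨
  parity (b + d)          ∎
  where open ≡-Reasoning

parity[m+m]≡0ℙ : ∀ m → parity (m + m) ≡ 0ℙ
parity[m+m]≡0ℙ m = trans (ℙ.+-homo-+ m m) (ℙ.p+p≡0ℙ (parity m))

parity≡0ℙ⇔2∣ : ∀ m → parity m ≡ 0ℙ ⇔ 2 ∣ m
parity≡0ℙ⇔2∣ m = mk⇔ (to m) from
  where
  to : ∀ m → parity m ≡ 0ℙ → 2 ∣ m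
  to zero          _  = divides 0 refl
  to (suc (suc m)) eq = ∣m∣n⇒∣m+n (∣-refl {2}) (to m eq)
  from : 2 ∣ m → parity m ≡ 0ℙ
  from (divides q refl) = trans (ℙ.*-homo-* q 2) (ℙ.*-zeroʳ (parity q))

parity-∑<-cong : ∀ n {f g : ℕ → ℕ} → (∀ j → j < n → parity (f j) ≡ parity (g j)) →
                 parity (∑< n f) ≡ parity (∑< n g)
parity-∑<-cong zero    f≡g = refl
parity-∑<-cong (suc n) {f} {g} f≡g =
  parity-+-cong {f 0} {g 0} {∑< n (f ∘ suc)} {∑< n (g ∘ suc)} (f≡g 0 (s≤s z≤n))
    (parity-∑<-cong n {f ∘ suc} {g ∘ suc} (λ j j<n → f≡g (suc j) (s≤s j<n)))

parity-∑<-∑<-symmetric : ∀ n (f : ℕ → ℕ → ℕ) → (∀ a b → f a b ≡ f b a) →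
  parity (∑[ a < n ] ∑[ b < n ] f a b) ≡ parity (∑[ a < n ] f a a)
parity-∑<-∑<-symmetric zero    f sym-f = refl
parity-∑<-∑<-symmetric (suc n) f sym-f = begin
  parity ((f 0 0 + row) + ∑[ a < n ] (f (suc a) 0 + ∑[ b < n ] f (suc a) (suc b)))
    ≡⟨ cong (λ x → parity ((f 0 0 + row) + x))
            (∑<-distrib-+ n (λ a → f (suc a) 0) (λ a → ∑[ b < n ] f (suc a) (suc b))) ⟩
  parity ((f 0 0 + row) + (column + rest))
    ≡⟨ cong (λ x → parity ((f 0 0 + row) + (x + rest))) column≡row ⟩
  parity ((f 0 0 + row) + (row + rest))
    ≡⟨ cong (λ x → parity (x + (row + rest))) (ℕ.+-comm (f 0 0) row) ⟩
  parity ((row + f 0 0) + (row + rest))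
    ≡⟨ cong parity (interchange row (f 0 0) row rest) ⟩
  parity ((row + row) + (f 0 0 + rest))
    ≡⟨ parity-+-cong {row + row} {0} {f 0 0 + rest} {f 0 0 + rest} (parity[m+m]≡0ℙ row) refl ⟩
  parity (f 0 0 + rest)
    ≡⟨ parity-+-cong {f 0 0} {f 0 0} {rest} refl
         (parity-∑<-∑<-symmetric n (λ a b → f (suc a) (suc b)) (λ a b → sym-f (suc a) (suc b))) ⟩
  parity (f 0 0 + ∑[ a < n ] f (suc a) (suc a)) ∎
  where
  open ≡-Reasoning
  row column rest : ℕ
  row    = ∑[ b < n ] f 0 (suc b)
  column = ∑[ a < n ] f (suc a) 0
  rest   = ∑[ a < n ] ∑[ b < n ] f (suc a) (suc b)
  column≡row : column ≡ row
  column≡row = ∑<-cong n (λ a _ → sym-f (suc a) 0)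

-- Through `does`, 𝟙 (suc j ≟ suc i) reduces to 𝟙 (j ≟ i); ∑<-δ relies on this.
𝟙 : ∀ {p} {P : Set p} → Dec P → ℕ
𝟙 P? = if does P? then 1 else 0

𝟙-⇔ : ∀ {p q} {P : Set p} {Q : Set q} → P ⇔ Q → (P? : Dec P) (Q? : Dec Q) → 𝟙 P? ≡ 𝟙 Q?
𝟙-⇔ P⇔Q P? Q? = cong (λ b → if b then 1 else 0) (does-⇔ P⇔Q P? Q?)

𝟙-no : ∀ {p} {P : Set p} → ¬ P → (P? : Dec P) → 𝟙 P? ≡ 0
𝟙-no ¬p P? = cong (λ b → if b then 1 else 0) (dec-false P? ¬p)

∑<-δ : ∀ {n i} (f : ℕ → ℕ) → i < n → ∑[ j < n ] (𝟙 (j ≟ i) * f j) ≡ f i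
∑<-δ {suc n} {zero}  f _         =
  trans (cong₂ _+_ (ℕ.+-identityʳ (f 0)) (∑<-zero n)) (ℕ.+-identityʳ (f 0))
∑<-δ {suc n} {suc i} f (s≤s i<n) = ∑<-δ (f ∘ suc) i<n

sum-map-concat : ∀ {a} {A : Set a} (g : A → ℕ) xss →
                 sum (map g (concat xss)) ≡ sum (map (λ xs → sum (map g xs)) xss)
sum-map-concat g []         = refl
sum-map-concat g (xs ∷ xss) = begin
  sum (map g (xs ++ concat xss))              ≡⟨ cong sum (map-++ g xs (concat xss)) ⟩
  sum (map g xs ++ map g (concat xss))        ≡⟨ sum-++ (map g xs) (map g (concat xss)) ⟩
  sum (map g xs) + sum (map g (concat xss))   ≡⟨ cong (sum (map g xs) +_) (sum-map-concat g xss) ⟩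
  sum (map g xs) + sum (map (λ xs → sum (map g xs)) xss) ∎
  where open ≡-Reasoning

sum-map-concatMap : ∀ {a b} {A : Set a} {B : Set b} (g : B → ℕ) (h : A → List B) xs →
                    sum (map g (concatMap h xs)) ≡ sum (map (λ x → sum (map g (h x))) xs)
sum-map-concatMap g h xs = trans (sum-map-concat g (map h xs)) (cong sum (sym (map-∘ xs)))

count : ∀ {a p} {A : Set a} {P : Pred A p} → Decidable P → List A → ℕ
count P? xs = sum (map (λ x → 𝟙 (P? x)) xs)

withHead : ∀ {a p} {A : Set a} {P : Pred (List A) p} → Decidable P → ∀ x → Decidable (λ xs → P (x ∷ xs))
withHead P? x xs = P? (x ∷ xs)

module _ {a} {A : Set a} where

  module _ {p} {P : Pred A p} (P? : Decidable P) where

    length-filter≡count : ∀ xs → length (filter P? xs) ≡ count P? xs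
    length-filter≡count []       = refl
    length-filter≡count (x ∷ xs) with P? x
    ... | yes _ = cong suc (length-filter≡count xs)
    ... | no  _ = length-filter≡count xs

    count-concat : ∀ xss → count P? (concat xss) ≡ sum (map (count P?) xss)
    count-concat = sum-map-concat (λ x → 𝟙 (P? x))

    count-concatMap : ∀ {b} {B : Set b} (h : B → List A) xs →
                      count P? (concatMap h xs) ≡ sum (map (λ x → count P? (h x)) xs)
    count-concatMap = sum-map-concatMap (λ x → 𝟙 (P? x))

    count-map : ∀ {b} {B : Set b} (f : B → A) xs → count P? (map f xs) ≡ count (λ x → P? (f x)) xs
    count-map f xs = cong sum (sym (map-∘ xs))

    count-≡0 : (∀ x → ¬ P x) → ∀ xs → count P? xs ≡ 0
    count-≡0 ¬P []       = refl
    count-≡0 ¬P (x ∷ xs) = cong₂ _+_ (𝟙-no (¬P x) (P? x)) (count-≡0 ¬P xs)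

  count-⇔ : ∀ {p q} {P : Pred A p} {Q : Pred A q} (P? : Decidable P) (Q? : Decidable Q) →
            (∀ x → P x ⇔ Q x) → ∀ xs → count P? xs ≡ count Q? xs
  count-⇔ P? Q? P⇔Q xs = cong sum (map-cong (λ x → 𝟙-⇔ (P⇔Q x) (P? x) (Q? x)) xs)

m+n≡o⇔m≤o×n≡o∸m : ∀ {m n o} → m + n ≡ o ⇔ (m ≤ o × n ≡ o ∸ m)
m+n≡o⇔m≤o×n≡o∸m {m} {n} = mk⇔
  (λ m+n≡o → subst (m ≤_) m+n≡o (ℕ.m≤m+n m n) , trans (sym (ℕ.m+n∸m≡n m n)) (cong (_∸ m) m+n≡o))
  (λ (m≤o , n≡o∸m) → trans (cong (m +_) n≡o∸m) (ℕ.m+[n∸m]≡n m≤o))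

k*m≡s∸m⇔[1+k]*m≡s : ∀ {k m s} → m ≤ s → k * m ≡ s ∸ m ⇔ suc k * m ≡ s
k*m≡s∸m⇔[1+k]*m≡s m≤s = mk⇔
  (λ eq → Equivalence.from m+n≡o⇔m≤o×n≡o∸m (m≤s , eq))
  (λ eq → proj₂ (Equivalence.to m+n≡o⇔m≤o×n≡o∸m eq))

m*m≡n*n⇒m≡n : ∀ {m n} → m * m ≡ n * n → m ≡ n
m*m≡n*n⇒m≡n {m} {n} m²≡n² with ℕ.<-cmp m n
... | tri< m<n _ _ = contradiction m²≡n² (ℕ.<⇒≢ (ℕ.*-mono-< m<n m<n))
... | tri≈ _ m≡n _ = m≡n
... | tri> _ _ n<m = contradiction (sym m²≡n²) (ℕ.<⇒≢ (ℕ.*-mono-< n<m n<m))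

Linked-changeHead : ∀ {a ℓ} {A : Set a} {R : Rel A ℓ} {x x′ xs} →
                    (∀ {y} → R x y → R x′ y) → Linked R (x ∷ xs) → Linked R (x′ ∷ xs)
Linked-changeHead f [-]        = [-]
Linked-changeHead f (Rxy ∷ Rs) = f Rxy ∷ Rs

parts≤head : ∀ {m b ys} → Linked NonIncr ((m , b) ∷ ys) → All (_≤ m) (parts ys)
parts≤head {ys = []}    [-]      = []
parts≤head {m} {b} {_ ∷ _} (le ∷ l) =
  All.map⁺ (Linked⇒All {R = NonIncr} (λ x≥y y≥z → ℕ.≤-trans y≥z x≥y) {v = m , b} le l)

largestPart-∷ : ∀ {m} ps → All (_≤ m) ps → largestPart (m ∷ ps) ≡ m
largestPart-∷ ps ps≤m = ℕ.m≥n⇒m⊔n≡m (foldr-preservesᵇ ℕ.⊔-lub z≤n ps≤m)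

m∸smallestPart-∷≤⇔ : ∀ {m t} ps → m ∸ smallestPart (m ∷ ps) ≤ t ⇔ All (λ p → m ∸ p ≤ t) ps
m∸smallestPart-∷≤⇔ {m} {t} ps = mk⇔
  (foldr-forcesᵇ (λ x y h → let h′ = subst (_≤ t) (ℕ.∸-distribˡ-⊓-⊔ m x y) h in
                              ℕ.m⊔n≤o⇒m≤o _ _ h′ , ℕ.m⊔n≤o⇒n≤o _ _ h′) m ps)
  (foldr-preservesᵇ (λ {x} {y} hx hy → subst (_≤ t) (sym (ℕ.∸-distribˡ-⊓-⊔ m x y)) (ℕ.⊔-lub hx hy))
                    (subst (_≤ t) (sym (ℕ.n∸n≡0 m)) z≤n))

spread-∷≤⇔ : ∀ {m t ps} → All (_≤ m) ps →
  largestPart (m ∷ ps) ∸ smallestPart (m ∷ ps) ≤ t ⇔ All (λ p → m ∸ p ≤ t) ps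
spread-∷≤⇔ {ps = ps} ps≤m rewrite largestPart-∷ ps ps≤m = m∸smallestPart-∷≤⇔ ps

-- The entries that may follow a part prev in an overpartition with largest part top and spread
-- at most t, summing to s; the overline flag of the predecessor never matters.
IsTail : (t top prev s : ℕ) → List OPart → Set
IsTail t top prev s ys =
  All (λ p → 1 ≤ proj₁ p) ys × sum (parts ys) ≡ s
  × Linked NonIncr ((prev , false) ∷ ys) × Linked OverlineOK ((prev , false) ∷ ys)
  × All (λ p → top ∸ p ≤ t) (parts ys)

isTail? : ∀ t top prev s → Decidable (IsTail t top prev s)
isTail? t top prev s ys =
  all? (λ p → 1 ≤? proj₁ p) ys ×-dec sum (parts ys) ≟ s
  ×-dec linked? nonIncr? _ ×-dec linked? overlineOK? _
  ×-dec all? (λ p → top ∸ p ≤? t) (parts ys)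
  where
  nonIncr? : ∀ x y → Dec (NonIncr x y)
  nonIncr? x y = proj₁ y ≤? proj₁ x
  overlineOK? : ∀ x y → Dec (OverlineOK x y)
  overlineOK? x y = (proj₂ y Bool.≟ true) →-dec ¬? (proj₁ x ≟ proj₁ y)

IsTail-∷ : ∀ {t top prev s m b ys} →
  IsTail t top prev s ((m , b) ∷ ys) ⇔
  (1 ≤ m × m ≤ prev × (b ≡ true → prev ≢ m) × top ∸ m ≤ t × m ≤ s × IsTail t top m (s ∸ m) ys)
IsTail-∷ = mk⇔
  (λ { (pos ∷ poss , sum≡ , le ∷ decr , ok ∷ oks , near ∷ nears) →
         let m≤s , sum≡′ = Equivalence.to m+n≡o⇔m≤o×n≡o∸m sum≡ in
         pos , le , ok , near , m≤s ,
         poss , sum≡′ , Linked-changeHead id decr , Linked-changeHead id oks , nears })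
  (λ (pos , le , ok , near , m≤s , poss , sum≡′ , decr , oks , nears) →
     pos ∷ poss , Equivalence.from m+n≡o⇔m≤o×n≡o∸m (m≤s , sum≡′) ,
     le ∷ Linked-changeHead id decr , ok ∷ Linked-changeHead id oks , near ∷ nears)

IsOverpartitionT-∷ : ∀ {t n m b ys} → 1 ≤ m → m ≤ n →
  IsOverpartitionT t n ((m , b) ∷ ys) ⇔ IsTail t m m (n ∸ m) ys
IsOverpartitionT-∷ 1≤m m≤n = mk⇔
  (λ { ((_ ∷ poss , sum≡ , decr , oks) , spread) →
         poss , proj₂ (Equivalence.to m+n≡o⇔m≤o×n≡o∸m sum≡) ,
         Linked-changeHead id decr , Linked-changeHead id oks ,
         Equivalence.to (spread-∷≤⇔ (parts≤head decr)) spread })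
  (λ (poss , sum≡ , decr , oks , nears) →
     (1≤m ∷ poss , Equivalence.from m+n≡o⇔m≤o×n≡o∸m (m≤n , sum≡) ,
      Linked-changeHead id decr , Linked-changeHead id oks) ,
     Equivalence.from (spread-∷≤⇔ (parts≤head decr)) nears)

IsTail-[] : ∀ {t top prev s} → IsTail t top prev s [] ⇔ 0 ≡ s
IsTail-[] = mk⇔ (λ (_ , sum≡ , _) → sum≡) (λ sum≡ → [] , sum≡ , [-] , [-] , [])

IsTail-overline-irrelevant : ∀ {t top prev s e b b′ ys} → prev ≢ e →
  IsTail t top prev s ((e , b) ∷ ys) → IsTail t top prev s ((e , b′) ∷ ys)
IsTail-overline-irrelevant prev≢e tail =
  let pos , le , _ , rest = Equivalence.to IsTail-∷ tail in
  Equivalence.from IsTail-∷ (pos , le , (λ _ → prev≢e) , rest)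

IsTail-repeat : ∀ {t top m s ys} → 1 ≤ m → top ∸ m ≤ t →
  IsTail t top m s ((m , false) ∷ ys) ⇔ (m ≤ s × IsTail t top m (s ∸ m) ys)
IsTail-repeat 1≤m near = mk⇔
  (λ tail → let _ , _ , _ , _ , rest = Equivalence.to IsTail-∷ tail in rest)
  (λ rest → Equivalence.from IsTail-∷ (1≤m , ℕ.≤-refl , (λ ()) , near , rest))

IsTail-overlined-repeat : ∀ {t top m s ys} → ¬ IsTail t top m s ((m , true) ∷ ys)
IsTail-overlined-repeat tail = let _ , _ , overlineOK , _ = Equivalence.to IsTail-∷ tail in overlineOK refl refl

count-listsOfLength-suc : ∀ {p} {P : Pred (List OPart) p} (P? : Decidable P) k es →
  count P? (listsOfLength (suc k) es) ≡
  sum (map (λ e → count (withHead P? e) (listsOfLength k es)) es)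
count-listsOfLength-suc P? k es =
  trans (count-concatMap P? (λ e → map (e ∷_) (listsOfLength k es)) es)
        (cong sum (map-cong (λ e → count-map P? (e ∷_) (listsOfLength k es)) es))

sum-map-entries : ∀ (g : OPart → ℕ) n →
  sum (map g (entries n)) ≡ ∑[ j < n ] (g (suc j , false) + g (suc j , true))
sum-map-entries g n = begin
  sum (map g (entries n))                                  ≡⟨ sum-map-concatMap g pair (upTo n) ⟩
  sum (map (λ j → sum (map g (pair j))) (upTo n))          ≡⟨ cong sum (map-upTo _ n) ⟩
  ∑[ j < n ] (g (suc j , false) + (g (suc j , true) + 0))
    ≡⟨ ∑<-cong n (λ j _ → cong (g (suc j , false) +_) (ℕ.+-identityʳ _)) ⟩
  ∑[ j < n ] (g (suc j , false) + g (suc j , true))        ∎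
  where
  open ≡-Reasoning
  pair : ℕ → List OPart
  pair j = (suc j , false) ∷ (suc j , true) ∷ []

square⇒∑𝟙-roots≡1 : ∀ {n} → 1 ≤ n → IsPerfectSquare n → ∑[ a < n ] 𝟙 (suc a * suc a ≟ n) ≡ 1
square⇒∑𝟙-roots≡1 {n} _ (suc r , r²≡n) = begin
  ∑[ a < n ] 𝟙 (suc a * suc a ≟ n)
    ≡⟨ ∑<-cong n (λ a _ → trans (𝟙-⇔ (root⇔ a) (suc a * suc a ≟ n) (a ≟ r)) (sym (ℕ.*-identityʳ _))) ⟩
  ∑[ a < n ] (𝟙 (a ≟ r) * 1)
    ≡⟨ ∑<-δ (λ _ → 1) (subst (suc r ≤_) r²≡n (ℕ.m≤m*n (suc r) (suc r))) ⟩
  1 ∎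
  where
  open ≡-Reasoning
  root⇔ : ∀ a → suc a * suc a ≡ n ⇔ a ≡ r
  root⇔ a = mk⇔ (λ a²≡n → ℕ.suc-injective (m*m≡n*n⇒m≡n (trans a²≡n (sym r²≡n))))
                (λ { refl → r²≡n })
square⇒∑𝟙-roots≡1 1≤n (zero , refl) = contradiction 1≤n λ ()

nonsquare⇒∑𝟙-roots≡0 : ∀ {n} → ¬ IsPerfectSquare n → ∑[ a < n ] 𝟙 (suc a * suc a ≟ n) ≡ 0
nonsquare⇒∑𝟙-roots≡0 {n} nonsquare =
  trans (∑<-cong n (λ a _ → 𝟙-no (λ a²≡n → nonsquare (suc a , a²≡n)) (suc a * suc a ≟ n))) (∑<-zero n)

module _ (t n : ℕ) where

  private
    L : ℕ → List (List OPart)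
    L k = listsOfLength k (entries n)

  count-L-suc : ∀ {p} {P : Pred (List OPart) p} (P? : Decidable P) k →
    count P? (L (suc k)) ≡
    ∑[ j < n ] (count (withHead P? (suc j , false)) (L k) + count (withHead P? (suc j , true)) (L k))
  count-L-suc P? k =
    trans (count-listsOfLength-suc P? k (entries n)) (sum-map-entries (λ e → count (withHead P? e) (L k)) n)

  tails : (k top prev s : ℕ) → ℕ
  tails k top prev s = count (isTail? t top prev s) (L k)

  -- Toggling the overline of a first entry different from prev pairs up the tails, so mod 2
  -- only the tails that repeat prev survive.
  tails-suc-parity : ∀ {top j₀} → j₀ < n → ∀ k s →
    parity (tails (suc k) top (suc j₀) s) ≡
    parity (count (withHead (isTail? t top (suc j₀) s) (suc j₀ , false)) (L k))
  tails-suc-parity {top} {j₀} j₀<n k s = begin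
    parity (tails (suc k) top (suc j₀) s)           ≡⟨ cong parity (count-L-suc tail? k) ⟩
    parity (∑[ j < n ] (unbarred j + barred j))     ≡⟨ parity-∑<-cong n (λ j _ → pair-parity j (j ≟ j₀)) ⟩
    parity (∑[ j < n ] (𝟙 (j ≟ j₀) * unbarred j))   ≡⟨ cong parity (∑<-δ unbarred j₀<n) ⟩
    parity (unbarred j₀)                            ∎
    where
    open ≡-Reasoning
    tail? : Decidable (IsTail t top (suc j₀) s)
    tail? = isTail? t top (suc j₀) s
    unbarred barred : ℕ → ℕ
    unbarred j = count (withHead tail? (suc j , false)) (L k)
    barred   j = count (withHead tail? (suc j , true)) (L k)
    pair-parity : ∀ j (j≟j₀ : Dec (j ≡ j₀)) →
                  parity (unbarred j + barred j) ≡ parity (𝟙 j≟j₀ * unbarred j)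
    pair-parity j (yes refl) = cong (λ x → parity (unbarred j + x))
      (count-≡0 (withHead tail? (suc j , true)) (λ _ → IsTail-overlined-repeat) (L k))
    pair-parity j (no j≢j₀) =
      trans (cong (λ x → parity (x + barred j)) unbarred≡barred) (parity[m+m]≡0ℙ (barred j))
      where
      toggle : ∀ {b b′} ys →
               IsTail t top (suc j₀) s ((suc j , b) ∷ ys) → IsTail t top (suc j₀) s ((suc j , b′) ∷ ys)
      toggle _ = IsTail-overline-irrelevant (λ eq → j≢j₀ (sym (ℕ.suc-injective eq)))
      unbarred≡barred : unbarred j ≡ barred j
      unbarred≡barred = count-⇔ (withHead tail? (suc j , false)) (withHead tail? (suc j , true))
                                (λ ys → mk⇔ (toggle ys) (toggle ys)) (L k)

  tails-parity : ∀ {top j₀} → j₀ < n → top ∸ suc j₀ ≤ t → ∀ k s →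
    parity (tails k top (suc j₀) s) ≡ parity (𝟙 (k * suc j₀ ≟ s))
  tails-parity {top} {j₀} j₀<n near zero s =
    cong parity (trans (ℕ.+-identityʳ _) (𝟙-⇔ IsTail-[] (isTail? t top (suc j₀) s []) (0 ≟ s)))
  tails-parity {top} {j₀} j₀<n near (suc k) s =
    trans (tails-suc-parity j₀<n k s) (repeat-parity (m ≤? s))
    where
    m : ℕ
    m = suc j₀
    tail? : Decidable (IsTail t top m s)
    tail? = isTail? t top m s
    repeat : ∀ ys → IsTail t top m s ((m , false) ∷ ys) ⇔ (m ≤ s × IsTail t top m (s ∸ m) ys)
    repeat _ = IsTail-repeat (s≤s z≤n) near
    repeat-parity : Dec (m ≤ s) →
      parity (count (withHead tail? (m , false)) (L k)) ≡ parity (𝟙 (suc k * m ≟ s))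
    repeat-parity (yes m≤s) = begin
      parity (count (withHead tail? (m , false)) (L k))
        ≡⟨ cong parity (count-⇔ (withHead tail? (m , false)) (isTail? t top m (s ∸ m))
             (λ ys → mk⇔ (proj₂ ∘ Equivalence.to (repeat ys))
                         (λ rest → Equivalence.from (repeat ys) (m≤s , rest)))
             (L k)) ⟩
      parity (tails k top m (s ∸ m))   ≡⟨ tails-parity j₀<n near k (s ∸ m) ⟩
      parity (𝟙 (k * m ≟ s ∸ m))
        ≡⟨ cong parity (𝟙-⇔ (k*m≡s∸m⇔[1+k]*m≡s {k} m≤s) (k * m ≟ s ∸ m) (suc k * m ≟ s)) ⟩
      parity (𝟙 (suc k * m ≟ s))       ∎
      where open ≡-Reasoning
    repeat-parity (no m≰s) = cong parity (trans
      (count-≡0 (withHead tail? (m , false)) (λ ys rest → m≰s (proj₁ (Equivalence.to (repeat ys) rest))) (L k))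
      (sym (𝟙-no (λ eq → m≰s (proj₁ (Equivalence.to m+n≡o⇔m≤o×n≡o∸m eq))) (suc k * m ≟ s))))

  private
    P? : Decidable (IsOverpartitionT t n)
    P? = isOverpartitionT? t n

  -- The overpartitions of n into k + 1 parts whose largest part j + 1 is not overlined.
  unbarredLargest : (k j : ℕ) → ℕ
  unbarredLargest k j = tails k (suc j) (suc j) (n ∸ suc j)

  count-overpartitions-suc : ∀ k → count P? (L (suc k)) ≡ 2 * ∑[ j < n ] unbarredLargest k j
  count-overpartitions-suc k = begin
    count P? (L (suc k))
      ≡⟨ count-L-suc P? k ⟩
    ∑[ j < n ] (count (withHead P? (suc j , false)) (L k) + count (withHead P? (suc j , true)) (L k))
      ≡⟨ ∑<-cong n (λ j j<n → cong₂ _+_ (as-tails j<n) (trans (as-tails j<n) (sym (ℕ.+-identityʳ _)))) ⟩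
    ∑[ j < n ] (2 * unbarredLargest k j)
      ≡⟨ *-distribˡ-∑< 2 n (unbarredLargest k) ⟩
    2 * ∑[ j < n ] unbarredLargest k j ∎
    where
    open ≡-Reasoning
    as-tails : ∀ {j b} → j < n → count (withHead P? (suc j , b)) (L k) ≡ unbarredLargest k j
    as-tails {j} {b} j<n = count-⇔ (withHead P? (suc j , b)) (isTail? t (suc j) (suc j) (n ∸ suc j))
      (λ _ → IsOverpartitionT-∷ (s≤s z≤n) j<n) (L k)

  pbarT≡2*∑∑unbarredLargest : 1 ≤ n → pbarT t n ≡ 2 * ∑[ k < n ] ∑[ j < n ] unbarredLargest k j
  pbarT≡2*∑∑unbarredLargest 1≤n = begin
    pbarT t n                                          ≡⟨ length-filter≡count P? (candidates n) ⟩
    count P? (concat (applyUpTo L (suc n)))            ≡⟨ count-concat P? (applyUpTo L (suc n)) ⟩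
    sum (map (count P?) (applyUpTo L (suc n)))         ≡⟨ cong sum (map-applyUpTo L (count P?) (suc n)) ⟩
    count P? (L 0) + ∑[ k < n ] count P? (L (suc k))
      ≡⟨ cong₂ _+_ no-empty-overpartition (∑<-cong n (λ k _ → count-overpartitions-suc k)) ⟩
    ∑[ k < n ] (2 * ∑[ j < n ] unbarredLargest k j)
      ≡⟨ *-distribˡ-∑< 2 n (λ k → ∑[ j < n ] unbarredLargest k j) ⟩
    2 * ∑[ k < n ] ∑[ j < n ] unbarredLargest k j ∎
    where
    open ≡-Reasoning
    no-empty-overpartition : count P? (L 0) ≡ 0
    no-empty-overpartition =
      trans (ℕ.+-identityʳ _) (𝟙-no (λ ((_ , sum≡n , _) , _) → ℕ.<⇒≢ 1≤n sum≡n) (P? []))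

  parity-∑∑unbarredLargest :
    parity (∑[ k < n ] ∑[ j < n ] unbarredLargest k j) ≡ parity (∑[ a < n ] 𝟙 (suc a * suc a ≟ n))
  parity-∑∑unbarredLargest = begin
    parity (∑[ k < n ] ∑[ j < n ] unbarredLargest k j)
      ≡⟨ parity-∑<-cong n (λ k _ → parity-∑<-cong n (λ j j<n → unbarredLargest-parity k j<n)) ⟩
    parity (∑[ k < n ] ∑[ j < n ] 𝟙 (suc k * suc j ≟ n))
      ≡⟨ parity-∑<-∑<-symmetric n (λ k j → 𝟙 (suc k * suc j ≟ n))
           (λ k j → cong (λ x → 𝟙 (x ≟ n)) (ℕ.*-comm (suc k) (suc j))) ⟩
    parity (∑[ a < n ] 𝟙 (suc a * suc a ≟ n)) ∎
    where
    open ≡-Reasoning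
    unbarredLargest-parity : ∀ k {j} → j < n → parity (unbarredLargest k j) ≡ parity (𝟙 (suc k * suc j ≟ n))
    unbarredLargest-parity k {j} j<n = trans
      (tails-parity j<n (subst (_≤ t) (sym (ℕ.n∸n≡0 j)) z≤n) k (n ∸ suc j))
      (cong parity (𝟙-⇔ (k*m≡s∸m⇔[1+k]*m≡s {k} j<n) (k * suc j ≟ n ∸ suc j) (suc k * suc j ≟ n)))

  2∣∑∑unbarredLargest⇔nonsquare : 1 ≤ n →
    (2 ∣ ∑[ k < n ] ∑[ j < n ] unbarredLargest k j) ⇔ (¬ IsPerfectSquare n)
  2∣∑∑unbarredLargest⇔nonsquare 1≤n = mk⇔
    (λ 2∣half square → 0ℙ≢1ℙ (begin
      0ℙ                                        ≡⟨ Equivalence.from (parity≡0ℙ⇔2∣ _) 2∣half ⟨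
      parity (∑[ k < n ] ∑[ j < n ] unbarredLargest k j) ≡⟨ parity-∑∑unbarredLargest ⟩
      parity (∑[ a < n ] 𝟙 (suc a * suc a ≟ n)) ≡⟨ cong parity (square⇒∑𝟙-roots≡1 1≤n square) ⟩
      1ℙ                                        ∎))
    (λ nonsquare → Equivalence.to (parity≡0ℙ⇔2∣ _)
      (trans parity-∑∑unbarredLargest (cong parity (nonsquare⇒∑𝟙-roots≡0 nonsquare))))
    where
    open ≡-Reasoning
    0ℙ≢1ℙ : 0ℙ ≢ 1ℙ
    0ℙ≢1ℙ ()

4∣2*m⇔2∣m : ∀ m → 4 ∣ 2 * m ⇔ 2 ∣ m
4∣2*m⇔2∣m m = mk⇔ (*-cancelˡ-∣ 2) (*-monoʳ-∣ 2)

mainTheorem3 : (t n : ℕ) → 1 ≤ n →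
    (2 ∣ pbarT t n) × ((4 ∣ pbarT t n) ⇔ (¬ IsPerfectSquare n))
mainTheorem3 t n 1≤n =
  subst (λ p → (2 ∣ p) × ((4 ∣ p) ⇔ (¬ IsPerfectSquare n))) (sym (pbarT≡2*∑∑unbarredLargest t n 1≤n))
    (m∣m*n half , 2∣∑∑unbarredLargest⇔nonsquare t n 1≤n ⇔-∘ 4∣2*m⇔2∣m half)
  where
  half : ℕ
  half = ∑[ k < n ] ∑[ j < n ] unbarredLargest t n k j
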